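{- Let $k, n, q \ge 1$ be integers. Then $\mathrm{HG}(W_{k,n}) \ge q$ if and only if there exist $q$ pairwise disjoint subsets of $[q]^{(k-1)n} = ([q]^{k-1})^n$, each of the form \[ \overline{S_1} \times \overline{S_2} \times \cdots \times \overline{S_n}, \] where each $S_i \subseteq [q]^{k-1}$ is a solvable set of $K_{k-1}$ with $q$ colors and $\overline{S_i} = [q]^{k-1} \setminus S_i$.
   Context: $[q] = \{0,1,\dots,q-1\}$. Hat-guessing game on a finite simple graph $G$ with $q$ colors: each vertex receives a hat color from $[q]$; each vertex's guess of its own color is a deterministic function of its neighbors' colors; the players win if for every assignment some vertex guesses correctly. $\mathrm{HG}(G)$ is the largest $q$ admitting a winning strategy. For a graph $G$ on $m$ vertices, a set $S \subseteq [q]^m$ of color assignments is a solvable set of $G$ with $q$ colors if there is a strategy such that for every assignment in $S$ at least one vertex guesses correctly. The windmill graph $W_{k,n}$ is obtained by taking $n$ copies of $K_k$ and identifying one vertex from each copy into a single common vertex; it has $(k-1)n+1$ vertices. -}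

module Defs where

open import Data.Nat using (ℕ; zero; suc; _∸_; _≤_)
open import Data.Fin using (Fin)
open import Data.Bool using (Bool; true; false)
open import Data.Maybe using (Maybe; just; nothing)
open import Data.Product using (Σ; ∃; _×_; _,_)
open import Data.Empty using (⊥)
open import Data.Unit using (⊤)
open import Relation.Nullary using (¬_)
open import Relation.Binary.PropositionalEquality using (_≡_; _≢_)

record Graph (V : Set) : Set₁ where
  field
    Adj   : V → V → Set
    sym   : ∀ {u v} → Adj u v → Adj v u
    irrefl : ∀ {v} → ¬ Adj v v
open Graph public

Assignment : Set → ℕ → Set
Assignment V q = V → Fin q

record Strategy {V : Set} (G : Graph V) (q : ℕ) : Set where
  field
    guess : V → Assignment V q → Fin q
    local : ∀ v (c c' : Assignment V q) →
            (∀ u → Adj G v u → c u ≡ c' u) → guess v c ≡ guess v c'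
open Strategy public

Succeeds : {V : Set} {G : Graph V} {q : ℕ} → Strategy G q → Assignment V q → Set
Succeeds {V} s c = Σ V λ v → guess s v c ≡ c v

Winning : {V : Set} → Graph V → ℕ → Set
Winning {V} G q = Σ (Strategy G q) λ s → ∀ (c : Assignment V q) → Succeeds s c

-- HG(G) ≥ q : the largest number of colours admitting a winning strategy is
-- at least q, i.e. some q' ≥ q admits a winning strategy.
HG≥ : {V : Set} → Graph V → ℕ → Set
HG≥ G q = Σ ℕ λ q' → q ≤ q' × Winning G q'

-- Subsets of assignments, as Bool-valued characteristic functions.
-- S is a solvable set of G with q colours.
Solvable : {V : Set} (G : Graph V) (q : ℕ) → (Assignment V q → Bool) → Set
Solvable {V} G q S =
  Σ (Strategy G q) λ s → ∀ (c : Assignment V q) → S c ≡ true → Succeeds s c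

K : (m : ℕ) → Graph (Fin m)
K m = record { Adj = λ a b → a ≢ b
             ; sym = λ p e → p (Relation.Binary.PropositionalEquality.sym e)
             ; irrefl = λ p → p Relation.Binary.PropositionalEquality.refl }

-- Windmill graph W_{k,n}: the common vertex is `nothing`; `just (i , a)` is
-- the a-th non-common vertex (a : Fin (k-1)) of the i-th copy of K_k.
-- This vertex type has (k-1)n+1 elements.
WVertex : ℕ → ℕ → Set
WVertex k n = Maybe (Fin n × Fin (k ∸ 1))

WAdj : ∀ n m → Maybe (Fin n × Fin m) → Maybe (Fin n × Fin m) → Set
WAdj n m nothing nothing = ⊥
WAdj n m nothing (just _) = ⊤
WAdj n m (just _) nothing = ⊤
WAdj n m (just (i , a)) (just (j , b)) = i ≡ j × a ≢ b

WAdj-sym : ∀ n m {u v} → WAdj n m u v → WAdj n m v u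
WAdj-sym n m {nothing} {nothing} ()
WAdj-sym n m {nothing} {just _} p = p
WAdj-sym n m {just _} {nothing} p = p
WAdj-sym n m {just _} {just _} (e , ne) =
  Relation.Binary.PropositionalEquality.sym e ,
  (λ x → ne (Relation.Binary.PropositionalEquality.sym x))

WAdj-irrefl : ∀ n m {v} → ¬ WAdj n m v v
WAdj-irrefl n m {nothing} ()
WAdj-irrefl n m {just _} (_ , ne) = ne Relation.Binary.PropositionalEquality.refl

Windmill : (k n : ℕ) → Graph (WVertex k n)
Windmill k n = record { Adj = WAdj n (k ∸ 1) ; sym = WAdj-sym n (k ∸ 1)
                      ; irrefl = WAdj-irrefl n (k ∸ 1) }

InProdCompl : ∀ n m q → (Fin n → (Fin m → Fin q) → Bool) →
              (Fin n → Fin m → Fin q) → Set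
InProdCompl n m q S x = ∀ i → S i (x i) ≡ false

-- The centre of W_{k,n} sees every blade vertex, while a blade vertex sees only the
-- centre and its own blade. Once the centre's colour j is fixed, blade i plays a
-- strategy σ_{j,i} on K_{k-1}, and whenever all n blades fail the centre must be right.
-- Its guess does not depend on j, so the products of the failure sets of σ_{j,1},…,σ_{j,n},
-- i.e. of the complements of their (solvable) success sets, are pairwise disjoint.
-- Conversely, for solvable sets S_{j,i} solved by σ_{j,i} the failure sets lie inside the
-- complements; the blades play σ_{c(centre),i} and the centre guesses the unique j whose
-- failure product contains what it sees. More colours never hurt: clamping the guesses
-- turns a winning strategy for q' ≥ q colours into one for q.
module Submission where

open import Defs hiding (sym)
open import Data.Nat using (ℕ; suc; _≤_; _∸_; _⊓_; s≤s)
open import Data.Nat.Properties using (≤-refl; m⊓n≤n; m≤n⇒m⊓n≡m)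
open import Data.Fin using (Fin; zero; toℕ; fromℕ<; inject≤; _≟_)
open import Data.Fin.Properties using (any?; all?; toℕ-fromℕ<; toℕ-inject≤; toℕ≤pred[n]; toℕ-injective)
open import Data.Vec using (Vec; tabulate; lookup)
open import Data.Vec.Properties using (tabulate-cong; lookup∘tabulate)
open import Data.Bool using (Bool; true; false)
open import Data.Maybe using (Maybe; just; nothing)
open import Data.Product using (Σ; _×_; _,_; proj₁)
open import Data.Unit using (tt)
open import Relation.Nullary using (¬_; Dec; yes; no; ¬?; contradiction)
open import Relation.Nullary.Decidable using (isYes; decidable-stable)
open import Relation.Binary.PropositionalEquality
  using (_≡_; _≢_; refl; sym; trans; cong; module ≡-Reasoning)
open import Function using (_∘′_)
open import Function.Bundles using (_⇔_; mk⇔)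

winning-retract : ∀ {V} {G : Graph V} {q q'} (ι : Fin q → Fin q') (ρ : Fin q' → Fin q) →
                  (∀ y → ρ (ι y) ≡ y) → Winning G q' → Winning G q
winning-retract {G = G} ι ρ ρ∘ι≡id (s , win) = s' , win'
  where
  s' : Strategy G _
  s' = record
    { guess = λ v c → ρ (guess s v (λ u → ι (c u)))
    ; local = λ v c c' c≈c' → cong ρ (local s v _ _ (λ u adj → cong ι (c≈c' u adj)))
    }
  win' : ∀ c → Succeeds s' c
  win' c with win (λ u → ι (c u))
  ... | v , correct = v , trans (cong ρ correct) (ρ∘ι≡id (c v))

clamp : ∀ q₀ {q'} → Fin q' → Fin (suc q₀)
clamp q₀ x = fromℕ< (s≤s (m⊓n≤n (toℕ x) q₀))

clamp-inject≤ : ∀ {q₀ q'} (le : suc q₀ ≤ q') (y : Fin (suc q₀)) → clamp q₀ (inject≤ y le) ≡ y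
clamp-inject≤ {q₀} le y = toℕ-injective (begin
  toℕ (clamp q₀ (inject≤ y le)) ≡⟨ toℕ-fromℕ< _ ⟩
  toℕ (inject≤ y le) ⊓ q₀       ≡⟨ cong (_⊓ q₀) (toℕ-inject≤ y le) ⟩
  toℕ y ⊓ q₀                    ≡⟨ m≤n⇒m⊓n≡m (toℕ≤pred[n] y) ⟩
  toℕ y                         ∎)
  where open ≡-Reasoning

HG≥⇒winning : ∀ {V} (G : Graph V) q₀ → HG≥ G (suc q₀) → Winning G (suc q₀)
HG≥⇒winning G q₀ (q' , le , win) = winning-retract (λ y → inject≤ y le) (clamp q₀) (clamp-inject≤ le) win

succeeds-resp : ∀ {V} {G : Graph V} {q} (s : Strategy G q) {c c' : Assignment V q} →
                (∀ v → c v ≡ c' v) → Succeeds s c → Succeeds s c'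
succeeds-resp s {c} {c'} c≗c' (v , correct) =
  v , trans (sym (local s v c c' (λ u _ → c≗c' u))) (trans correct (c≗c' v))

solvable⇒∉ : ∀ {V} {G : Graph V} {q} {S : Assignment V q → Bool} {c} →
             ((s , covers) : Solvable G q S) → ¬ Succeeds s c → S c ≡ false
solvable⇒∉ {S = S} {c} (s , covers) fails with S c in c∈S
... | true  = contradiction (covers c c∈S) fails
... | false = refl

module _ {m q} {G : Graph (Fin m)} (s : Strategy G q) where

  succeeds? : ∀ c → Dec (Succeeds s c)
  succeeds? c = any? (λ v → guess s v c ≟ c v)

  successSet : Assignment (Fin m) q → Bool
  successSet c = isYes (succeeds? c)

  successSet-solvable : Solvable G q successSet
  successSet-solvable = s , covers
    where
    covers : ∀ c → successSet c ≡ true → Succeeds s c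
    covers c c∈S with succeeds? c
    ... | yes succeeds = succeeds

  ∉successSet : ∀ {c} → successSet c ≡ false → ¬ Succeeds s c
  ∉successSet {c} c∉S with succeeds? c
  ... | no fails = fails

toTable : ∀ {A : Set} {n m} → (Fin n → Fin m → A) → Vec (Vec A m) n
toTable x = tabulate (λ i → tabulate (x i))

fromTable : ∀ {A : Set} {n m} → Vec (Vec A m) n → Fin n → Fin m → A
fromTable t i b = lookup (lookup t i) b

toTable-cong : ∀ {A : Set} {n m} {x y : Fin n → Fin m → A} →
               (∀ i b → x i b ≡ y i b) → toTable x ≡ toTable y
toTable-cong x≗y = tabulate-cong (λ i → tabulate-cong (x≗y i))

fromTable-toTable : ∀ {A : Set} {n m} (x : Fin n → Fin m → A) i b → fromTable (toTable x) i b ≡ x i b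
fromTable-toTable x i b = begin
  lookup (lookup (toTable x) i) b ≡⟨ cong (λ r → lookup r b) (lookup∘tabulate _ i) ⟩
  lookup (tabulate (x i)) b       ≡⟨ lookup∘tabulate (x i) b ⟩
  x i b                           ∎
  where open ≡-Reasoning

glue : ∀ {n m q} → Fin q → (Fin n → Fin m → Fin q) → Maybe (Fin n × Fin m) → Fin q
glue j x nothing        = j
glue j x (just (i , b)) = x i b

blades : ∀ {n m q} → (Maybe (Fin n × Fin m) → Fin q) → Fin n → Fin m → Fin q
blades c i b = c (just (i , b))

module FromWinning {k n q} (s : Strategy (Windmill k n) q) (win : ∀ c → Succeeds s c) where

  -- Any colouring of the other blades would do: a blade vertex does not see them.
  bladeStrategy : Fin q → Fin n → Strategy (K (k ∸ 1)) q
  bladeStrategy j i = record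
    { guess = λ a y → guess s (just (i , a)) (glue j (λ _ → y))
    ; local = λ a y y' y≈y' → local s (just (i , a)) _ _ λ
        { nothing _ → refl
        ; (just (.i , b)) (refl , a≢b) → y≈y' b a≢b }
    }

  guess-blade : ∀ j x i a → guess s (just (i , a)) (glue j x) ≡ guess (bladeStrategy j i) a (x i)
  guess-blade j x i a = local s (just (i , a)) _ _ λ
    { nothing _ → refl
    ; (just (.i , b)) (refl , _) → refl }

  solvedBy : Fin q → Fin n → (Fin (k ∸ 1) → Fin q) → Bool
  solvedBy j i = successSet (bladeStrategy j i)

  solvedBy-solvable : ∀ j i → Solvable (K (k ∸ 1)) q (solvedBy j i)
  solvedBy-solvable j i = successSet-solvable (bladeStrategy j i)

  -- If every blade fails, the centre is the only vertex left to guess correctly.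
  guess-centre : ∀ j x → InProdCompl n (k ∸ 1) q (solvedBy j) x → guess s nothing (glue j x) ≡ j
  guess-centre j x x∉ with win (glue j x)
  ... | nothing , correct = correct
  ... | just (i , a) , correct =
    contradiction (a , trans (sym (guess-blade j x i a)) correct)
                  (∉successSet (bladeStrategy j i) (x∉ i))

  solvedBy-disjoint : ∀ j j' → j ≢ j' → ∀ x →
    ¬ (InProdCompl n (k ∸ 1) q (solvedBy j) x × InProdCompl n (k ∸ 1) q (solvedBy j') x)
  solvedBy-disjoint j j' j≢j' x (x∉j , x∉j') = j≢j' (begin
    j                               ≡⟨ sym (guess-centre j x x∉j) ⟩
    guess s nothing (glue j x)      ≡⟨ local s nothing _ _ (λ { nothing () ; (just _) _ → refl }) ⟩
    guess s nothing (glue j' x)     ≡⟨ guess-centre j' x x∉j' ⟩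
    j'                              ∎)
    where open ≡-Reasoning

module ToWinning {k n q₀} (σ : Fin (suc q₀) → Fin n → Strategy (K (k ∸ 1)) (suc q₀)) where

  Unsolved : Fin (suc q₀) → (Fin n → Fin (k ∸ 1) → Fin (suc q₀)) → Set
  Unsolved j x = ∀ i → ¬ Succeeds (σ j i) (x i)

  unsolved? : ∀ j x → Dec (Unsolved j x)
  unsolved? j x = all? (λ i → ¬? (succeeds? (σ j i) (x i)))

  module _ (unsolved-unique : ∀ j j' x → Unsolved j x → Unsolved j' x → j ≡ j') where

    choose : (Fin n → Fin (k ∸ 1) → Fin (suc q₀)) → Fin (suc q₀)
    choose x with any? (λ j → unsolved? j x)
    ... | yes (j , _) = j
    ... | no _        = zero

    choose-unsolved : ∀ j x → Unsolved j x → choose x ≡ j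
    choose-unsolved j x unsolved with any? (λ j → unsolved? j x)
    ... | yes (j' , unsolved') = unsolved-unique j' j x unsolved' unsolved
    ... | no none              = contradiction (j , unsolved) none

    -- The centre sees the blades only through their table, which makes its guess local.
    windmillGuess : WVertex k n → Assignment (WVertex k n) (suc q₀) → Fin (suc q₀)
    windmillGuess nothing        c = choose (fromTable (toTable (blades c)))
    windmillGuess (just (i , a)) c = guess (σ (c nothing) i) a (blades c i)

    guess-cong : ∀ {j j'} i a {y y'} → j ≡ j' → (∀ b → a ≢ b → y b ≡ y' b) →
                 guess (σ j i) a y ≡ guess (σ j' i) a y'
    guess-cong {j} i a refl y≈y' = local (σ j i) a _ _ y≈y'

    windmillGuess-local : ∀ v c c' → (∀ u → WAdj n (k ∸ 1) v u → c u ≡ c' u) →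
                          windmillGuess v c ≡ windmillGuess v c'
    windmillGuess-local nothing c c' c≈c' =
      cong (λ t → choose (fromTable t)) (toTable-cong (λ i b → c≈c' (just (i , b)) tt))
    windmillGuess-local (just (i , a)) c c' c≈c' =
      guess-cong i a (c≈c' nothing tt) (λ b a≢b → c≈c' (just (i , b)) (refl , a≢b))

    windmillStrategy : Strategy (Windmill k n) (suc q₀)
    windmillStrategy = record { guess = windmillGuess ; local = windmillGuess-local }

    windmillStrategy-wins : ∀ c → Succeeds windmillStrategy c
    windmillStrategy-wins c with any? (λ i → succeeds? (σ (c nothing) i) (blades c i))
    ... | yes (i , a , correct) = just (i , a) , correct
    ... | no none = nothing , choose-unsolved (c nothing) _ λ i →
          none ∘′ (i ,_) ∘′ succeeds-resp (σ (c nothing) i) (fromTable-toTable (blades c) i)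

module FromSolvableSets {k n q₀} (S : Fin (suc q₀) → Fin n → (Fin (k ∸ 1) → Fin (suc q₀)) → Bool)
  (solvable : ∀ j i → Solvable (K (k ∸ 1)) (suc q₀) (S j i))
  (disjoint : ∀ j j' → j ≢ j' → ∀ x →
    ¬ (InProdCompl n (k ∸ 1) (suc q₀) (S j) x × InProdCompl n (k ∸ 1) (suc q₀) (S j') x)) where

  open ToWinning {k} {n} (λ j i → proj₁ (solvable j i))

  unsolved-unique : ∀ j j' x → Unsolved j x → Unsolved j' x → j ≡ j'
  unsolved-unique j j' x unsolved unsolved' = decidable-stable (j ≟ j') λ j≢j' →
    disjoint j j' j≢j' x ( (λ i → solvable⇒∉ (solvable j i) (unsolved i))
                         , (λ i → solvable⇒∉ (solvable j' i) (unsolved' i)))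

  winning : Winning (Windmill k n) (suc q₀)
  winning = windmillStrategy unsolved-unique , windmillStrategy-wins unsolved-unique

mainTheorem12 : (k n q : ℕ) → 1 ≤ k → 1 ≤ n → 1 ≤ q →
    HG≥ (Windmill k n) q ⇔
    (Σ (Fin q → Fin n → (Fin (k ∸ 1) → Fin q) → Bool) λ S →
      (∀ j i → Solvable (K (k ∸ 1)) q (S j i)) ×
      (∀ j j' → j ≢ j' → ∀ (x : Fin n → Fin (k ∸ 1) → Fin q) →
        ¬ (InProdCompl n (k ∸ 1) q (S j) x × InProdCompl n (k ∸ 1) q (S j') x)))
-- Only 1 ≤ q is needed, for the clamping and for a default guess of the centre.
mainTheorem12 k n (suc q₀) _ _ _ = mk⇔
  (λ hg → let s , win = HG≥⇒winning (Windmill k n) q₀ hg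
              open FromWinning {k} {n} s win
          in solvedBy , solvedBy-solvable , solvedBy-disjoint)
  (λ (S , solvable , disjoint) → suc q₀ , ≤-refl , FromSolvableSets.winning {k} {n} S solvable disjoint)
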